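{- For every integer $n\ge 0$ we have $m(t(n)) \leq n+1$, and equality $m(t(n))=n+1$ holds if and only if the base-$4$ representation $(n)_4$ of $n$ belongs to the regular language $(0 \cup 1 1^* 0)^* 3^*$.
   Context: Let $(a(n))_{n\ge 0}$ be the Rudin-Shapiro sequence, defined by $a(0)=1$, $a(2n)=a(n)$, $a(2n+1)=(-1)^n a(n)$ for $n\ge 0$. Let $t(n)=\sum_{0\le i\le n}(-1)^i a(i)$ (which is a nonnegative integer for all $n$). For $k\ge 0$, $m(k)$ denotes the integer obtained by reading the base-$2$ representation of $k$ as a base-$4$ numeral; i.e., if $k=\sum_i c_i 2^i$ with $c_i\in\{0,1\}$, then $m(k)=\sum_i c_i 4^i$. The base-$4$ representation $(n)_4$ is the canonical one, most significant digit first, with no leading zeros; in particular $(0)_4$ is the empty string. -}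

module Defs where

open import Data.Nat using (ℕ; zero; suc; _+_; _*_; _/_; _%_)
open import Data.Integer as ℤ using (ℤ; +_; -_)
open import Data.List using (List; []; _∷_; _++_; reverse)

neg1^ : ℕ → ℤ
neg1^ zero = + 1
neg1^ (suc n) = - neg1^ n

-- Rudin–Shapiro sequence, computed with fuel (fuel suc n suffices for argument n,
-- since n / 2 < n for n ≥ 1).
-- a(0) = 1, a(2n) = a(n), a(2n+1) = (-1)^n a(n).
rsF : ℕ → ℕ → ℤ
rsF zero    _       = + 1
rsF (suc f) zero    = + 1
rsF (suc f) (suc n) with (suc n) % 2
... | zero  = rsF f (suc n / 2)
... | suc _ = neg1^ (suc n / 2) ℤ.* rsF f (suc n / 2)

a : ℕ → ℤ
a n = rsF (suc n) n

t : ℕ → ℤ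
t zero    = a 0
t (suc n) = t n ℤ.+ neg1^ (suc n) ℤ.* a (suc n)

-- m(k): read the binary digits of k as base-4 digits (fuel version; fuel k suffices).
mF : ℕ → ℕ → ℕ
mF zero    _ = 0
mF (suc f) k = k % 2 + 4 * mF f (k / 2)

m : ℕ → ℕ
m k = mF k k

digits4F : ℕ → ℕ → List ℕ
digits4F zero    _       = []
digits4F (suc f) zero    = []
digits4F (suc f) (suc n) = (suc n % 4) ∷ digits4F f (suc n / 4)

-- canonical base-4 representation, most significant digit first, (0)_4 = empty
base4 : ℕ → List ℕ
base4 n = reverse (digits4F n n)

data Ones0 : List ℕ → Set where
  ones-base : Ones0 (1 ∷ 0 ∷ [])
  ones-step : ∀ {w} → Ones0 w → Ones0 (1 ∷ w)

data Star : List ℕ → Set where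
  star-nil  : Star []
  star-zero : ∀ {w} → Star w → Star (0 ∷ w)
  star-blk  : ∀ {u w} → Ones0 u → Star w → Star (u ++ w)

data Threes : List ℕ → Set where
  threes-nil  : Threes []
  threes-cons : ∀ {w} → Threes w → Threes (3 ∷ w)

data Lang : List ℕ → Set where
  lang : ∀ {u v} → Star u → Threes v → Lang (u ++ v)

-- Write t⁻ n = t (n - 1) (and t⁻ 0 = 0).  From a(4q) = a(4q+1) = a(q) and
-- a(4q+2) = -a(4q+3) = (-1)^q a(q) one gets, with T = t⁻ q,
--   t⁻(4q) = 2T,  t(4q) = 2T + a(q),  t(4q+1) = 2T,
--   t(4q+2) = 2T + (-1)^q a(q),  t(4q+3) = 2 t(q).
-- As m(2x) = 4 m(x) and m(2x+1) = 4 m(x) + 1, appending a base-4 digit to q turns the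
-- bounds m(t q) ≤ q + 1 and m(t⁻ q) ≤ q into the corresponding bounds for 4q + r, and
-- equality survives exactly for the digits allowed by (0 ∪ 11*0)*3* for t and by
-- (0 ∪ 11*0)*1* for t⁻.  Both bounds are therefore proved together by induction on
-- the base-4 expansion, following both languages with one four-state automaton.

module Submission where

open import Defs
open import Data.Bool using (Bool; true; false)
open import Data.Bool.Properties using (¬-not)
open import Data.Empty using (⊥; ⊥-elim)
open import Data.Integer as ℤ using (ℤ; +_; -_; ∣_∣)
import Data.Integer.Properties as ℤ
open import Data.Integer.Tactic.RingSolver using (solve-∀)
open import Data.List using (List; []; _∷_; _++_; [_]; foldl; reverse)
open import Data.List.Properties using (++-assoc; foldl-++; unfold-reverse)
open import Data.Nat using (ℕ; zero; suc; _+_; _*_; _/_; _%_; _≤_; _<_; s≤s; z≤n; z<s; s<s; NonZero)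
open import Data.Nat.DivMod
open import Data.Nat.Divisibility using (divides-refl)
open import Data.Nat.Induction using (<-rec)
open import Data.Nat.Properties
open import Data.Product using (Σ-syntax; ∃-syntax; _×_; _,_; proj₁; proj₂)
open import Data.Sum using (_⊎_; inj₁; inj₂)
open import Function using (_∘_; case_of_)
open import Function.Bundles using (_⇔_; mk⇔; Equivalence)
import Function.Properties.Equivalence as ⇔
open import Relation.Binary.PropositionalEquality hiding ([_])

[m+kn]%n≡m : ∀ m k n .{{_ : NonZero n}} → m < n → (m + k * n) % n ≡ m
[m+kn]%n≡m m k n m<n = trans ([m+kn]%n≡m%n m k n) (m<n⇒m%n≡m m<n)

[m+kn]/n≡k : ∀ m k n .{{_ : NonZero n}} → m < n → (m + k * n) / n ≡ k
[m+kn]/n≡k m k n m<n =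
  trans (+-distrib-/-∣ʳ m (divides-refl k)) (cong₂ _+_ (m<n⇒m/n≡0 m<n) (m*n/n≡m k n))

/-≤-fuel : ∀ d k {f} .{{_ : NonZero d}} → 1 < d → k ≤ suc f → k / d ≤ f
/-≤-fuel d zero {f} _ _   = subst (_≤ f) (sym (0/n≡0 d)) z≤n
/-≤-fuel d (suc k) 1<d k≤f = ≤-pred (≤-trans (m/n<m (suc k) d 1<d) k≤f)

data Halving : ℕ → Set where
  even : ∀ k → Halving (k * 2)
  odd  : ∀ k → Halving (1 + k * 2)

halving : ∀ n → Halving n
halving zero = even 0
halving (suc n) with halving n
... | even k = odd k
... | odd k  = even (suc k)

/2-fuel : ∀ {n f} → suc n < suc f → suc n / 2 < f
/2-fuel {n} (s≤s n<f) = <-≤-trans (m/n<m (suc n) 2 (s<s z<s)) n<f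

rsF-fuel : ∀ {f g} n → n < f → n < g → rsF f n ≡ rsF g n
rsF-fuel {suc f} {suc g} zero _ _ = refl
rsF-fuel {suc f} {suc g} (suc n) n<f n<g with suc n % 2
... | zero  = rsF-fuel (suc n / 2) (/2-fuel n<f) (/2-fuel n<g)
... | suc _ = cong (neg1^ (suc n / 2) ℤ.*_) (rsF-fuel (suc n / 2) (/2-fuel n<f) (/2-fuel n<g))

rsF≡a : ∀ {f} n → n < f → rsF f n ≡ a n
rsF≡a n n<f = rsF-fuel n n<f ≤-refl

rsF-even : ∀ f n → suc n % 2 ≡ 0 → rsF (suc f) (suc n) ≡ rsF f (suc n / 2)
rsF-even f n eq rewrite eq = refl

rsF-odd : ∀ f n → suc n % 2 ≡ 1 → rsF (suc f) (suc n) ≡ neg1^ (suc n / 2) ℤ.* rsF f (suc n / 2)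
rsF-odd f n eq rewrite eq = refl

a-even : ∀ k → a (k * 2) ≡ a k
a-even zero    = refl
a-even (suc k) = begin
  a (suc k * 2)            ≡⟨ rsF-even fuel (suc (k * 2)) ([m+kn]%n≡m 0 (suc k) 2 z<s) ⟩
  rsF fuel (suc k * 2 / 2) ≡⟨ cong (rsF fuel) ([m+kn]/n≡k 0 (suc k) 2 z<s) ⟩
  rsF fuel (suc k)         ≡⟨ rsF≡a (suc k) (s<s (s<s (m≤m*n k 2))) ⟩
  a (suc k)                ∎
  where
  open ≡-Reasoning
  fuel = suc (suc (k * 2))

a-odd : ∀ k → a (1 + k * 2) ≡ neg1^ k ℤ.* a k
a-odd k = begin
  a (1 + k * 2)                 ≡⟨ rsF-odd fuel (k * 2) ([m+kn]%n≡m 1 k 2 (s<s z<s)) ⟩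
  neg1^ k′ ℤ.* rsF fuel k′      ≡⟨ cong (λ j → neg1^ j ℤ.* rsF fuel j) ([m+kn]/n≡k 1 k 2 (s<s z<s)) ⟩
  neg1^ k ℤ.* rsF fuel k        ≡⟨ cong (neg1^ k ℤ.*_) (rsF≡a k (s<s (m≤m*n k 2))) ⟩
  neg1^ k ℤ.* a k               ∎
  where
  open ≡-Reasoning
  fuel = suc (k * 2)
  k′   = (1 + k * 2) / 2

mF-zero : ∀ f → mF f 0 ≡ 0
mF-zero zero    = refl
mF-zero (suc f) = cong (4 *_) (mF-zero f)

mF-fuel : ∀ {f g} k → k ≤ f → k ≤ g → mF f k ≡ mF g k
mF-fuel {zero}  {g}     zero _ _ = sym (mF-zero g)
mF-fuel {suc f} {zero}  zero _ _ = mF-zero (suc f)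
mF-fuel {suc f} {suc g} k k≤f k≤g =
  cong (λ j → k % 2 + 4 * j) (mF-fuel (k / 2) (/-≤-fuel 2 k (s<s z<s) k≤f) (/-≤-fuel 2 k (s<s z<s) k≤g))

m-even : ∀ k → m (k * 2) ≡ m k * 4
m-even zero    = refl
m-even (suc k) = begin
  m (suc k * 2)                               ≡⟨⟩
  suc k * 2 % 2 + 4 * mF fuel (suc k * 2 / 2) ≡⟨ cong₂ (λ r j → r + 4 * mF fuel j)
                                                   ([m+kn]%n≡m 0 (suc k) 2 z<s) ([m+kn]/n≡k 0 (suc k) 2 z<s) ⟩
  4 * mF fuel (suc k)                         ≡⟨ cong (4 *_) (mF-fuel (suc k) (s<s (m≤m*n k 2)) ≤-refl) ⟩
  4 * m (suc k)                               ≡⟨ *-comm 4 (m (suc k)) ⟩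
  m (suc k) * 4                               ∎
  where
  open ≡-Reasoning
  fuel = suc (k * 2)

m-odd : ∀ k → m (1 + k * 2) ≡ 1 + m k * 4
m-odd k = begin
  m (1 + k * 2)                                   ≡⟨⟩
  (1 + k * 2) % 2 + 4 * mF fuel ((1 + k * 2) / 2) ≡⟨ cong₂ (λ r j → r + 4 * mF fuel j)
                                                       ([m+kn]%n≡m 1 k 2 (s<s z<s)) ([m+kn]/n≡k 1 k 2 (s<s z<s)) ⟩
  1 + 4 * mF fuel k                               ≡⟨ cong (λ j → 1 + 4 * j) (mF-fuel k (m≤m*n k 2) ≤-refl) ⟩
  1 + 4 * m k                                     ≡⟨ cong suc (*-comm 4 (m k)) ⟩
  1 + m k * 4                                     ∎
  where
  open ≡-Reasoning
  fuel = k * 2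

digits4F-zero : ∀ f → digits4F f 0 ≡ []
digits4F-zero zero    = refl
digits4F-zero (suc f) = refl

digits4F-fuel : ∀ {f g} n → n ≤ f → n ≤ g → digits4F f n ≡ digits4F g n
digits4F-fuel {f} {g} zero _ _ = trans (digits4F-zero f) (sym (digits4F-zero g))
digits4F-fuel {suc f} {suc g} (suc n) n≤f n≤g = cong (suc n % 4 ∷_)
  (digits4F-fuel (suc n / 4) (/-≤-fuel 4 (suc n) (s<s z<s) n≤f) (/-≤-fuel 4 (suc n) (s<s z<s) n≤g))

base4-suc : ∀ n → base4 (suc n) ≡ base4 (suc n / 4) ++ [ suc n % 4 ]
base4-suc n = trans (unfold-reverse (suc n % 4) (digits4F n (suc n / 4)))
  (cong (λ ds → reverse ds ++ [ suc n % 4 ]) (digits4F-fuel (suc n / 4) n/4≤n ≤-refl))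
  where
  n/4≤n : suc n / 4 ≤ n
  n/4≤n = /-≤-fuel 4 (suc n) (s<s z<s) ≤-refl

IsUnit : ℤ → Set
IsUnit i = i ≡ + 1 ⊎ i ≡ - + 1

IsUnit-* : ∀ {i j} → IsUnit i → IsUnit j → IsUnit (i ℤ.* j)
IsUnit-* (inj₁ refl) (inj₁ refl) = inj₁ refl
IsUnit-* (inj₁ refl) (inj₂ refl) = inj₂ refl
IsUnit-* (inj₂ refl) (inj₁ refl) = inj₂ refl
IsUnit-* (inj₂ refl) (inj₂ refl) = inj₁ refl

neg1^-unit : ∀ n → IsUnit (neg1^ n)
neg1^-unit zero = inj₁ refl
neg1^-unit (suc n) with neg1^-unit n
... | inj₁ eq = inj₂ (cong -_ eq)
... | inj₂ eq = inj₁ (cong -_ eq)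

rsF-unit : ∀ f n → IsUnit (rsF f n)
rsF-unit zero    _       = inj₁ refl
rsF-unit (suc f) zero    = inj₁ refl
rsF-unit (suc f) (suc n) with suc n % 2
... | zero  = rsF-unit f (suc n / 2)
... | suc _ = IsUnit-* (neg1^-unit (suc n / 2)) (rsF-unit f (suc n / 2))

a-unit : ∀ n → IsUnit (a n)
a-unit n = rsF-unit (suc n) n

neg1^-even : ∀ k → neg1^ (k * 2) ≡ + 1
neg1^-even zero    = refl
neg1^-even (suc k) = cong (-_ ∘ -_) (neg1^-even k)

*4≡*2*2 : ∀ q → q * 4 ≡ q * 2 * 2
*4≡*2*2 q = sym (*-assoc q 2 2)

neg1^-4q : ∀ q → neg1^ (q * 4) ≡ + 1
neg1^-4q q rewrite *4≡*2*2 q = neg1^-even (q * 2)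

a-4q : ∀ q → a (q * 4) ≡ a q
a-4q q rewrite *4≡*2*2 q = trans (a-even (q * 2)) (a-even q)

a-4q+1 : ∀ q → a (1 + q * 4) ≡ a q
a-4q+1 q rewrite *4≡*2*2 q | a-odd (q * 2) | neg1^-even q | a-even q = ℤ.*-identityˡ (a q)

a-4q+2 : ∀ q → a (2 + q * 4) ≡ neg1^ q ℤ.* a q
a-4q+2 q rewrite *4≡*2*2 q = trans (a-even (1 + q * 2)) (a-odd q)

a-4q+3 : ∀ q → a (3 + q * 4) ≡ - (neg1^ q ℤ.* a q)
a-4q+3 q rewrite *4≡*2*2 q | a-odd (1 + q * 2) | neg1^-even q | a-odd q = ℤ.-1*i≡-i _

t⁻ : ℕ → ℤ
t⁻ zero    = + 0
t⁻ (suc n) = t n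

summand : ℕ → ℤ
summand n = neg1^ n ℤ.* a n

summand-unit : ∀ n → IsUnit (summand n)
summand-unit n = IsUnit-* (neg1^-unit n) (a-unit n)

t≡t⁻+summand : ∀ n → t n ≡ t⁻ n ℤ.+ summand n
t≡t⁻+summand zero    = refl
t≡t⁻+summand (suc n) = refl

x+y-y≡x : ∀ x y → x ℤ.+ y ℤ.+ - + 1 ℤ.* y ≡ x
x+y-y≡x = solve-∀

x+x+y+y≡[x+y]+[x+y] : ∀ x y → x ℤ.+ x ℤ.+ y ℤ.+ - + 1 ℤ.* - y ≡ (x ℤ.+ y) ℤ.+ (x ℤ.+ y)
x+x+y+y≡[x+y]+[x+y] = solve-∀

t⁻-4q   : ∀ q → t⁻ (q * 4) ≡ t⁻ q ℤ.+ t⁻ q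
t-4q    : ∀ q → t (q * 4) ≡ t⁻ q ℤ.+ t⁻ q ℤ.+ a q
t-4q+1  : ∀ q → t (1 + q * 4) ≡ t⁻ q ℤ.+ t⁻ q
t-4q+2  : ∀ q → t (2 + q * 4) ≡ t⁻ q ℤ.+ t⁻ q ℤ.+ summand q
t-4q+3  : ∀ q → t (3 + q * 4) ≡ t q ℤ.+ t q

t⁻-4q zero    = refl
t⁻-4q (suc q) = t-4q+3 q

t-4q q rewrite t≡t⁻+summand (q * 4) | t⁻-4q q | neg1^-4q q | a-4q q =
  cong (ℤ._+_ (t⁻ q ℤ.+ t⁻ q)) (ℤ.*-identityˡ (a q))

t-4q+1 q rewrite t-4q q | neg1^-4q q | a-4q+1 q = x+y-y≡x (t⁻ q ℤ.+ t⁻ q) (a q)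

t-4q+2 q rewrite t-4q+1 q | neg1^-4q q | a-4q+2 q =
  cong (ℤ._+_ (t⁻ q ℤ.+ t⁻ q)) (ℤ.*-identityˡ (summand q))

t-4q+3 q rewrite t-4q+2 q | neg1^-4q q | a-4q+3 q | t≡t⁻+summand q =
  x+x+y+y≡[x+y]+[x+y] (t⁻ q) (summand q)

x*2≡x+x : ∀ x → x * 2 ≡ x + x
x*2≡x+x x = trans (*-comm x 2) (cong (_+_ x) (+-identityʳ x))

double : ∀ {i x} → i ≡ + x → i ℤ.+ i ≡ + (x * 2)
double {x = x} refl = cong +_ (sym (x*2≡x+x x))

double+1 : ∀ {i j x} → i ≡ + x → j ≡ + 1 → i ℤ.+ i ℤ.+ j ≡ + (1 + x * 2)
double+1 {x = x} refl refl = cong +_ (trans (+-comm (x + x) 1) (cong suc (sym (x*2≡x+x x))))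

double-1 : ∀ {i j x} → i ≡ + suc x → j ≡ - + 1 → i ℤ.+ i ℤ.+ j ≡ + (1 + x * 2)
double-1 {x = x} refl refl = cong +_ (trans (+-suc x x) (cong suc (sym (x*2≡x+x x))))

+v≡+u-1⇒u≡1+v : ∀ {u v} → + v ≡ + u ℤ.+ - + 1 → u ≡ suc v
+v≡+u-1⇒u≡1+v {suc u} eq = cong suc (sym (ℤ.+-injective eq))

m-<-suc : ∀ n → m n < m (suc n)
m-<-suc = <-rec (λ n → m n < m (suc n)) step
  where
  step : ∀ n → (∀ {k} → k < n → m k < m (suc k)) → m n < m (suc n)
  step n rec with halving n
  ... | even k = subst₂ _<_ (sym (m-even k)) (sym (m-odd k)) ≤-refl
  ... | odd k  = subst₂ _<_ (sym (m-odd k)) (sym (m-even (suc k))) (begin-strict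
    1 + m k * 4         <⟨ s≤s (s≤s (m≤n+m (m k * 4) 2)) ⟩
    suc (m k) * 4       ≤⟨ *-monoˡ-≤ 4 (rec (s≤s (m≤m*n k 2))) ⟩
    m (suc k) * 4       ∎)
    where open ≤-Reasoning

record Tight (k N : ℕ) (b : Bool) : Set where
  field
    bound    : k ≤ N
    attained : k ≡ N ⇔ b ≡ true

tight-refl : ∀ N → Tight N N true
tight-refl N = record { bound = ≤-refl ; attained = mk⇔ (λ _ → refl) (λ _ → refl) }

tight-< : ∀ {k N} → k < N → Tight k N false
tight-< k<N = record { bound = <⇒≤ k<N ; attained = mk⇔ (λ k≡N → ⊥-elim (<-irrefl k≡N k<N)) λ () }

tight-* : ∀ {k N b} c .{{_ : NonZero c}} → Tight k N b → Tight (k * c) (N * c) b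
tight-* {k} {N} c T = record
  { bound    = *-monoˡ-≤ c bound
  ; attained = mk⇔ (to attained ∘ *-cancelʳ-≡ k N c) (cong (_* c) ∘ from attained)
  }
  where open Tight T; open Equivalence

tight-suc : ∀ {k N b} → Tight k N b → Tight (suc k) (suc N) b
tight-suc T = record
  { bound    = s≤s bound
  ; attained = mk⇔ (to attained ∘ suc-injective) (cong suc ∘ from attained)
  }
  where open Tight T; open Equivalence

tight-m-even : ∀ x {N b} → Tight (m x) N b → Tight (m (x * 2)) (N * 4) b
tight-m-even x {N} {b} T = subst (λ k → Tight k (N * 4) b) (sym (m-even x)) (tight-* 4 T)

tight-m-odd : ∀ x {N b} → Tight (m x) N b → Tight (m (1 + x * 2)) (1 + N * 4) b
tight-m-odd x {N} {b} T = subst (λ k → Tight k (1 + N * 4) b) (sym (m-odd x)) (tight-suc (tight-* 4 T))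

OddTight : ℤ → ℕ → Bool → Set
OddTight i N b = Σ[ y ∈ ℕ ] i ≡ + (1 + y * 2) × Tight (m (1 + y * 2)) N b

-- flagsOf w = (w ∈ (0 ∪ 11*0)*3* , w ∈ (0 ∪ 11*0)*1*)
flagsStep : Bool × Bool → ℕ → Bool × Bool
flagsStep (_ , f⁻) 0 = f⁻ , f⁻
flagsStep (_ , f⁻) 1 = false , f⁻
flagsStep (f , _)  3 = f , false
flagsStep _        _ = false , false

flagsOf : List ℕ → Bool × Bool
flagsOf = foldl flagsStep (true , true)

flags : ℕ → Bool × Bool
flags n = flagsOf (base4 n)

Residual : Bool × Bool → List ℕ → Set
Residual (true  , true)  w = Lang w
Residual (false , true)  w = ∃[ u ] ∃[ v ] (w ≡ u ++ v × Ones0 (1 ∷ u) × Lang v)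
Residual (true  , false) w = Threes w
Residual (false , false) w = ⊥

Residual-∷ : ∀ s d {w} → Residual (flagsStep s d) w → Residual s (d ∷ w)
Residual-∷ (true  , true)  0 (lang st th) = lang (star-zero st) th
Residual-∷ (false , true)  0 l            = 0 ∷ [] , _ , refl , ones-base , l
Residual-∷ (_     , false) 0 ()
Residual-∷ (true  , true)  1 (u , _ , refl , o , lang {v} {w} st th) =
  subst Lang (++-assoc (1 ∷ u) v w) (lang (star-blk o st) th)
Residual-∷ (false , true)  1 (u , v , refl , o , l) = 1 ∷ u , v , refl , ones-step o , l
Residual-∷ (_     , false) 1 ()
Residual-∷ _               2 ()
Residual-∷ (true  , true)  3 th = lang star-nil (threes-cons th)
Residual-∷ (true  , false) 3 th = threes-cons th
Residual-∷ (false , _)     3 ()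
Residual-∷ _ (suc (suc (suc (suc _)))) ()

accepted⇒Residual : ∀ s w → proj₁ (foldl flagsStep s w) ≡ true → Residual s w
accepted⇒Residual (true  , true)  []      _ = lang star-nil threes-nil
accepted⇒Residual (true  , false) []      _ = threes-nil
accepted⇒Residual (false , _)     []      ()
accepted⇒Residual s               (d ∷ w) h = Residual-∷ s d (accepted⇒Residual (flagsStep s d) w h)

Ones0⇒run : ∀ {f u} → Ones0 u → foldl flagsStep (f , true) u ≡ (true , true)
Ones0⇒run ones-base     = refl
Ones0⇒run (ones-step o) = Ones0⇒run o

Star⇒run : ∀ {w} → Star w → foldl flagsStep (true , true) w ≡ (true , true)
Star⇒run star-nil                 = refl
Star⇒run (star-zero st)           = Star⇒run st
Star⇒run (star-blk {u} {w} o st) = trans (foldl-++ flagsStep (true , true) u w)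
  (trans (cong (λ s → foldl flagsStep s w) (Ones0⇒run o)) (Star⇒run st))

Threes⇒run : ∀ {f⁻ w} → Threes w → proj₁ (foldl flagsStep (true , f⁻) w) ≡ true
Threes⇒run threes-nil       = refl
Threes⇒run (threes-cons th) = Threes⇒run th

Lang⇔accepted : ∀ w → Lang w ⇔ proj₁ (flagsOf w) ≡ true
Lang⇔accepted w = mk⇔ accepted (accepted⇒Residual (true , true) w)
  where
  accepted : ∀ {w} → Lang w → proj₁ (flagsOf w) ≡ true
  accepted (lang {u} {v} st th) = subst (λ s → proj₁ s ≡ true)
    (sym (trans (foldl-++ flagsStep (true , true) u v) (cong (λ s → foldl flagsStep s v) (Star⇒run st))))
    (Threes⇒run th)

flags-suc : ∀ n → flags (suc n) ≡ flagsStep (flags (suc n / 4)) (suc n % 4)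
flags-suc n = trans (cong flagsOf (base4-suc n)) (foldl-++ flagsStep (true , true) (base4 (suc n / 4)) _)

-- f stands for flags n.  The last two fields are only needed in the digits 0 and 1,
-- to see that 2 t⁻ q + a q is nonnegative and, when a q = -1, that it is not tight.
record Invariant (n : ℕ) (f : Bool × Bool) : Set where
  field
    now prev      : ℕ
    t≡now         : t n ≡ + now
    t⁻≡prev       : t⁻ n ≡ + prev
    now-tight     : Tight (m now) (suc n) (proj₁ f)
    prev-tight    : Tight (m prev) n (proj₂ f)
    prev≡0⇒even   : prev ≡ 0 → neg1^ n ≡ + 1
    prefinal⇒a≡1  : proj₂ f ≡ true → a n ≡ + 1

invariant-0 : Invariant 0 (true , true)
invariant-0 = record
  { now = 1 ; prev = 0 ; t≡now = refl ; t⁻≡prev = refl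
  ; now-tight = tight-refl 1 ; prev-tight = tight-refl 0
  ; prev≡0⇒even = λ _ → refl ; prefinal⇒a≡1 = λ _ → refl
  }

module Digit {q : ℕ} {f : Bool × Bool} (I : Invariant q f) where
  open Invariant I

  odd-below : ∀ y → m y ≤ q → Tight (m (1 + y * 2)) (3 + q * 4) false
  odd-below y my≤q = subst (λ k → Tight k (3 + q * 4) false) (sym (m-odd y))
    (tight-< (s≤s (s≤s (m≤n⇒m≤1+n (*-monoˡ-≤ 4 my≤q)))))

  twice-prev-below : Tight (m (prev * 2)) (2 + q * 4) false
  twice-prev-below = tight-< (s≤s (m≤n⇒m≤1+n (Tight.bound (tight-m-even prev prev-tight))))

  twice-t⁻+a : OddTight (t⁻ q ℤ.+ t⁻ q ℤ.+ a q) (1 + q * 4) (proj₂ f)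
  twice-t⁻+a with a-unit q
  ... | inj₁ a≡1  = prev , double+1 t⁻≡prev a≡1 , tight-m-odd prev prev-tight
  ... | inj₂ a≡-1 = below prev t⁻≡prev (Tight.bound prev-tight) prev≡0⇒even
    where
    prefinal≡false : proj₂ f ≡ false
    prefinal≡false = ¬-not (λ h → case trans (sym (prefinal⇒a≡1 h)) a≡-1 of λ ())
    below : ∀ u → t⁻ q ≡ + u → m u ≤ q → (u ≡ 0 → neg1^ q ≡ + 1) →
            OddTight (t⁻ q ℤ.+ t⁻ q ℤ.+ a q) (1 + q * 4) (proj₂ f)
    -- t⁻ q = 0 forces q even, and then t q = a q = -1
    below zero t⁻≡0 _ 0⇒even = case trans (sym t≡now) (trans (t≡t⁻+summand q)
      (cong₂ ℤ._+_ t⁻≡0 (cong₂ ℤ._*_ (0⇒even refl) a≡-1))) of λ ()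
    below (suc y) t⁻≡1+y m[1+y]≤q _ = y , double-1 t⁻≡1+y a≡-1
      , subst (Tight _ _) (sym prefinal≡false) (tight-m-odd y (tight-< (<-≤-trans (m-<-suc y) m[1+y]≤q)))

  twice-t⁻+summand : OddTight (t⁻ q ℤ.+ t⁻ q ℤ.+ summand q) (3 + q * 4) false
  twice-t⁻+summand with summand-unit q
  ... | inj₁ s≡1  = prev , double+1 t⁻≡prev s≡1 , odd-below prev (Tight.bound prev-tight)
  ... | inj₂ s≡-1 = now , double-1 (trans t⁻≡prev (cong +_ prev≡1+now)) s≡-1 , odd-below now m-now≤q
    where
    prev≡1+now : prev ≡ suc now
    prev≡1+now = +v≡+u-1⇒u≡1+v (trans (sym t≡now) (trans (t≡t⁻+summand q) (cong₂ ℤ._+_ t⁻≡prev s≡-1)))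
    m-now≤q : m now ≤ q
    m-now≤q = <⇒≤ (<-≤-trans (m-<-suc now) (subst (λ u → m u ≤ q) prev≡1+now (Tight.bound prev-tight)))

  digit-0 : Invariant (0 + q * 4) (flagsStep f 0)
  digit-0 with twice-t⁻+a
  ... | y , y-eq , y-tight = record
    { now = 1 + y * 2 ; prev = prev * 2
    ; t≡now = trans (t-4q q) y-eq ; t⁻≡prev = trans (t⁻-4q q) (double t⁻≡prev)
    ; now-tight = y-tight ; prev-tight = tight-m-even prev prev-tight
    ; prev≡0⇒even = λ _ → neg1^-4q q
    ; prefinal⇒a≡1 = trans (a-4q q) ∘ prefinal⇒a≡1
    }

  digit-1 : Invariant (1 + q * 4) (flagsStep f 1)
  digit-1 with twice-t⁻+a
  ... | y , y-eq , y-tight = record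
    { now = prev * 2 ; prev = 1 + y * 2
    ; t≡now = trans (t-4q+1 q) (double t⁻≡prev) ; t⁻≡prev = trans (t-4q q) y-eq
    ; now-tight = twice-prev-below ; prev-tight = y-tight
    ; prev≡0⇒even = λ ()
    ; prefinal⇒a≡1 = trans (a-4q+1 q) ∘ prefinal⇒a≡1
    }

  digit-2 : Invariant (2 + q * 4) (flagsStep f 2)
  digit-2 with twice-t⁻+summand
  ... | y , y-eq , y-tight = record
    { now = 1 + y * 2 ; prev = prev * 2
    ; t≡now = trans (t-4q+2 q) y-eq ; t⁻≡prev = trans (t-4q+1 q) (double t⁻≡prev)
    ; now-tight = y-tight ; prev-tight = twice-prev-below
    ; prev≡0⇒even = λ _ → cong (-_ ∘ -_) (neg1^-4q q)
    ; prefinal⇒a≡1 = λ ()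
    }

  digit-3 : Invariant (3 + q * 4) (flagsStep f 3)
  digit-3 with twice-t⁻+summand
  ... | y , y-eq , y-tight = record
    { now = now * 2 ; prev = 1 + y * 2
    ; t≡now = trans (t-4q+3 q) (double t≡now) ; t⁻≡prev = trans (t-4q+2 q) y-eq
    ; now-tight = tight-m-even now now-tight ; prev-tight = y-tight
    ; prev≡0⇒even = λ ()
    ; prefinal⇒a≡1 = λ ()
    }

invariant-digit : ∀ {q f} r → r < 4 → Invariant q f → Invariant (r + q * 4) (flagsStep f r)
invariant-digit 0 _ I = Digit.digit-0 I
invariant-digit 1 _ I = Digit.digit-1 I
invariant-digit 2 _ I = Digit.digit-2 I
invariant-digit 3 _ I = Digit.digit-3 I
invariant-digit (suc (suc (suc (suc _)))) (s≤s (s≤s (s≤s (s≤s ())))) _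

invariant : ∀ n → Invariant n (flags n)
invariant = <-rec (λ n → Invariant n (flags n)) step
  where
  step : ∀ n → (∀ {k} → k < n → Invariant k (flags k)) → Invariant n (flags n)
  step zero    _   = invariant-0
  step (suc n) rec = subst₂ Invariant (sym (m≡m%n+[m/n]*n (suc n) 4)) (sym (flags-suc n))
    (invariant-digit (suc n % 4) (m%n<n (suc n) 4) (rec (m/n<m (suc n) 4 (s<s z<s))))

lemma23 : (n : ℕ) →
    (m ∣ t n ∣ ≤ suc n) ×
    ((m ∣ t n ∣ ≡ suc n → Lang (base4 n)) × (Lang (base4 n) → m ∣ t n ∣ ≡ suc n))
lemma23 n rewrite Invariant.t≡now (invariant n) = bound , from tight⇔Lang , to tight⇔Lang
  where
  open Invariant (invariant n)
  open Tight now-tight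
  open Equivalence
  tight⇔Lang : Lang (base4 n) ⇔ m now ≡ suc n
  tight⇔Lang = ⇔.trans (Lang⇔accepted (base4 n)) (⇔.sym attained)
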